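{- Let $G$ and $H$ be ordered graphs on $[n]$, and let $a,b \in [n]$ with $a \leqslant b$. If $G - a = H - b$, then every edge of the symmetric difference $G \triangle H$ (i.e. every pair in exactly one of $E(G)$, $E(H)$) has an endpoint in $[a,b] = \{a, a+1, \ldots, b\}$.
   Context: An ordered graph on $[n]$ is a graph on vertex set $[n]$ with the usual order. For $v \in [n]$, $G - v$ is the induced subgraph on $[n]\setminus\{v\}$, identified with an ordered graph on $[n-1]$ via the order-preserving bijection; equality of $G-a$ and $H-b$ is equality after this identification. -}

module Defs where

open import Data.Nat using (ℕ; suc)
open import Data.Bool using (Bool; false)
open import Data.Fin using (Fin; punchIn; _≤_)
open import Data.Product using (_×_)
open import Relation.Binary.PropositionalEquality using (_≡_)

-- A (simple) ordered graph on [n]: vertex set Fin n with its usual order,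
-- adjacency is a symmetric, irreflexive Bool-valued relation.
record OrderedGraph (n : ℕ) : Set where
  field
    adj   : Fin n → Fin n → Bool
    sym   : ∀ i j → adj i j ≡ adj j i
    irrefl : ∀ i → adj i i ≡ false
open OrderedGraph public

-- G - v, identified with an ordered graph on [n-1] via the order-preserving
-- bijection Fin m → Fin (suc m) ∖ {v}, which is  punchIn v.
deleteAdj : ∀ {m} → OrderedGraph (suc m) → Fin (suc m) → Fin m → Fin m → Bool
deleteAdj G v i j = adj G (punchIn v i) (punchIn v j)

DeletionEq : ∀ {m} → OrderedGraph (suc m) → Fin (suc m) →
             OrderedGraph (suc m) → Fin (suc m) → Set
DeletionEq G a H b = ∀ i j → deleteAdj G a i j ≡ deleteAdj H b i j

InInterval : ∀ {n} → Fin n → Fin n → Fin n → Set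
InInterval a b x = (a ≤ x) × (x ≤ b)

module Submission where

-- Deleting a vertex v re-indexes the remaining vertices by
-- punchIn v : Fin m → Fin (suc m), the order-preserving injection that
-- skips v.  A vertex x lying strictly on the same side of both a and b
-- has the SAME index in G - a and in H - b: below both it keeps its index,
-- above both it moves down by one.  When a ≤ b, every vertex outside
-- [a , b] is of this kind.  So if x and y both lie outside [a , b], the
-- pair xy corresponds to one and the same pair x'y' of G - a and H - b,
-- and the hypothesis G - a = H - b gives adj G x y ≡ adj H x y; hence
-- an edge of the symmetric difference must meet [a , b].

open import Defs
open import Data.Nat using (ℕ; suc; s≤s) renaming (_≤_ to _≤ℕ_)
import Data.Nat.Properties as ℕ
open import Data.Fin using (Fin; zero; suc; toℕ; punchIn; _≤_; _<_)
open import Data.Fin.Properties using (_≤?_)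
open import Data.Product using (Σ-syntax; _×_; _,_)
open import Data.Sum using (_⊎_; inj₁; inj₂)
open import Relation.Nullary using (¬_; yes; no; contradiction)
open import Relation.Nullary.Decidable using (Dec; _×-dec_)
open import Relation.Binary.PropositionalEquality
  using (_≡_; _≢_; refl; cong; cong₂; module ≡-Reasoning)

SharedPreimage : ∀ {m} → Fin (suc m) → Fin (suc m) → Fin (suc m) → Set
SharedPreimage {m} a b x = Σ[ x' ∈ Fin m ] punchIn a x' ≡ x × punchIn b x' ≡ x

sharedPreimage-below : ∀ {m} {a b x : Fin (suc m)} →
                       x < a → x < b → SharedPreimage a b x
sharedPreimage-below {suc m} {suc a} {suc b} {zero}  _ _ = zero , refl , refl
sharedPreimage-below {suc m} {suc a} {suc b} {suc x} (s≤s x<a) (s≤s x<b)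
  with sharedPreimage-below {a = a} {b} {x} x<a x<b
... | x' , a-index , b-index = suc x' , cong suc a-index , cong suc b-index

punchIn-above : ∀ {m} (a : Fin (suc m)) (x : Fin m) →
                toℕ a ≤ℕ toℕ x → punchIn a x ≡ suc x
punchIn-above zero    x       _         = refl
punchIn-above (suc a) (suc x) (s≤s a≤x) = cong suc (punchIn-above a x a≤x)

sharedPreimage-above : ∀ {m} {a b x : Fin (suc m)} →
                       a < x → b < x → SharedPreimage a b x
sharedPreimage-above {a = a} {b} {suc x} (s≤s a≤x) (s≤s b≤x) =
  x , punchIn-above a x a≤x , punchIn-above b x b≤x

-- When a ≤ b, a vertex outside [a , b] lies strictly below or strictly
-- above both endpoints, hence has a shared preimage.
sharedPreimage-outside : ∀ {m} {a b x : Fin (suc m)} →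
                         a ≤ b → ¬ InInterval a b x → SharedPreimage a b x
sharedPreimage-outside {a = a} {b} {x} a≤b x∉[a,b] with a ≤? x | x ≤? b
... | yes a≤x | yes x≤b = contradiction (a≤x , x≤b) x∉[a,b]
... | no a≰x  | _       = sharedPreimage-below x<a (ℕ.<-≤-trans x<a a≤b)
  where x<a = ℕ.≰⇒> a≰x
... | yes _   | no x≰b  = sharedPreimage-above (ℕ.≤-<-trans a≤b b<x) b<x
  where b<x = ℕ.≰⇒> x≰b

deletionEq-agrees : ∀ {m} (G H : OrderedGraph (suc m)) {a b x y : Fin (suc m)} →
                    DeletionEq G a H b →
                    SharedPreimage a b x → SharedPreimage a b y →
                    adj G x y ≡ adj H x y
deletionEq-agrees G H {a} {b} {x} {y} G-a≡H-b
                  (x' , x-in-G , x-in-H) (y' , y-in-G , y-in-H) = begin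
  adj G x y                           ≡⟨ cong₂ (adj G) x-in-G y-in-G ⟨
  adj G (punchIn a x') (punchIn a y') ≡⟨ G-a≡H-b x' y' ⟩
  adj H (punchIn b x') (punchIn b y') ≡⟨ cong₂ (adj H) x-in-H y-in-H ⟩
  adj H x y                           ∎
  where open ≡-Reasoning

inInterval? : ∀ {n} (a b x : Fin n) → Dec (InInterval a b x)
inInterval? a b x = (a ≤? x) ×-dec (x ≤? b)

mainTheorem12 : (m : ℕ) (G H : OrderedGraph (suc m)) (a b : Fin (suc m)) →
    a ≤ b → DeletionEq G a H b →
    ∀ x y → adj G x y ≢ adj H x y →
    InInterval a b x ⊎ InInterval a b y
mainTheorem12 m G H a b a≤b G-a≡H-b x y differ
  with inInterval? a b x | inInterval? a b y
... | yes x∈[a,b] | _           = inj₁ x∈[a,b]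
... | no _        | yes y∈[a,b] = inj₂ y∈[a,b]
... | no x∉[a,b]  | no y∉[a,b]  = contradiction agree differ
  where
    agree : adj G x y ≡ adj H x y
    agree = deletionEq-agrees G H G-a≡H-b (sharedPreimage-outside a≤b x∉[a,b])
                                          (sharedPreimage-outside a≤b y∉[a,b])
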